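{- Let $p\geq 5$ be a fixed prime and $\ell\geq 1$ an integer. For $c\in\mathbb{Z}$ let $\varphi_{(p-1)^\ell,c}(z)=z^{(p-1)^\ell}+c$ and $$M_c(p):=\#\{z\in \mathbb{Z}/p\mathbb{Z} : \varphi_{(p-1)^\ell,c}(z)-z\equiv 0\pmod p\}.$$ Then $M_c(p)=1$ for every $c\equiv 1\pmod p$, $M_c(p)=2$ for every $c=pt$ with $t\in\mathbb{Z}$, and $M_c(p)=0$ for every $c\equiv -1\pmod p$. -}

module Defs where

open import Data.Nat as ℕ using (ℕ)
open import Data.Nat.Divisibility using (_∣?_)
open import Data.Integer as ℤ using (ℤ; +_)
import Data.Integer.Divisibility as ℤD
open import Data.Fin using (Fin; toℕ)
open import Data.List using (List; length; filter; allFin)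
open import Relation.Nullary using (Dec)

_^ℤ_ : ℤ → ℕ → ℤ
z ^ℤ ℕ.zero = + 1
z ^ℤ ℕ.suc n = z ℤ.* (z ^ℤ n)

φ : ℕ → ℤ → ℤ → ℤ
φ d c z = (z ^ℤ d) ℤ.+ c

-- decidability of integer divisibility (ℤ divisibility is ℕ divisibility of absolute values)
_∣ℤ?_ : (m n : ℤ) → Dec (m ℤD.∣ n)
m ∣ℤ? n = ℤ.∣ m ∣ ∣? ℤ.∣ n ∣

M : (p ℓ : ℕ) → ℤ → ℕ
M p ℓ c = length (filter (λ (z : Fin p) → (+ p) ∣ℤ? (φ ((p ℕ.∸ 1) ℕ.^ ℓ) c (+ toℕ z) ℤ.- (+ toℕ z))) (allFin p))

-- Fermat's little theorem, derived from the binomial theorem (p divides every inner binomial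
-- coefficient of (x + 1)^p), gives z^((p-1)^ℓ) ≡ [z ≠ 0] (mod p). So for c ≡ c₀ (mod p) with
-- c₀ ∈ {1, 0, -1}, a residue 0 ≤ z < p is a fixed point of φ modulo p exactly when p divides
-- [z ≠ 0] + c₀ - z; that integer has absolute value below p, hence must vanish, which happens
-- at z = 2 for c₀ = 1, at z = 0, 1 for c₀ = 0, and never for c₀ = -1.
module Submission where

open import Defs
open import Data.Nat as ℕ using (ℕ; zero; suc; z≤n; s≤s; _<_; _≤_)
import Data.Nat.Properties as ℕ
open import Data.Nat.Divisibility as ℕ using (divides)
open import Data.Nat.Primality
  using (Prime; euclidsLemma; prime⇒nonTrivial; prime⇒nonZero; ¬prime[0]; ¬prime[1])
open import Data.Nat.Combinatorics using (_C_; nCn≡1; nC1≡n; nCk+nC[k+1]≡[n+1]C[k+1])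
open import Data.Integer as ℤ using (ℤ; +_; 0ℤ; 1ℤ; _+_; _-_; _*_; -_; _^_; ∣_∣)
import Data.Integer.Properties as ℤ
open import Data.Integer.Divisibility using (_∣_)
import Data.Integer.Divisibility.Signed as Signed
open Signed using (divides; ∣ᵤ⇒∣; ∣⇒∣ᵤ; ∣m∣n⇒∣m+n; ∣m⇒∣-m; ∣n⇒∣m*n; ∣m⇒∣m*n)
open import Data.Integer.Tactic.RingSolver using (solve-∀)
open import Data.Fin using (Fin; zero; suc; toℕ; fromℕ; inject₁)
open import Data.List using (length; filter; allFin; tabulate)
open import Data.List.Properties using (filter-≐; filter-none)
open import Data.List.Relation.Unary.All.Properties using (tabulate⁺)
open import Data.Fin.Properties using (toℕ<n; toℕ-fromℕ; toℕ-inject₁)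
open import Data.Vec.Functional using (Vector)
open import Data.Sum using (inj₁; inj₂)
open import Data.Product using (_,_; _×_)
open import Data.Empty using (⊥-elim)
open import Relation.Nullary using (¬_; Dec)
open import Function.Base using (_∘_; _$_)
open import Level using (0ℓ)
open import Relation.Binary.Structures using (IsEquivalence)
open import Relation.Binary.Bundles using (Setoid)
import Relation.Binary.Reasoning.Setoid
open import Relation.Binary.PropositionalEquality
  using (_≡_; _≢_; refl; sym; trans; cong; cong₂; subst; module ≡-Reasoning)
open import Algebra.Definitions.RawSemiring ℤ.+-*-rawSemiring
  using (sum) renaming (_×_ to _·_; _^_ to _^′_)
open import Algebra.Properties.CommutativeSemiring.Binomial ℤ.+-*-commutativeSemiring
  using (binomialTerm) renaming (theorem to binomial-theorem)

infix 4 _≡_mod_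

-- A record, so that x and y are inferable; signed divisibility supplies the additive lemmas
-- that the unsigned _∣_ of the statement lacks.
record _≡_mod_ (x y : ℤ) (m : ℕ) : Set where
  constructor congruent
  field divides-difference : + m Signed.∣ x - y

open _≡_mod_

module _ {m : ℕ} where

  mod-reflexive : ∀ {x y} → x ≡ y → x ≡ y mod m
  mod-reflexive {x} refl = congruent $ divides 0ℤ (trans (ℤ.+-inverseʳ x) (sym (ℤ.*-zeroˡ (+ m))))

  mod-refl : ∀ {x} → x ≡ x mod m
  mod-refl = mod-reflexive refl

  mod-sym : ∀ {x y} → x ≡ y mod m → y ≡ x mod m
  mod-sym {x} {y} x≡y =
    congruent $ subst (+ m Signed.∣_) (negate-difference x y) (∣m⇒∣-m (divides-difference x≡y))
    where
    negate-difference : ∀ x y → - (x - y) ≡ y - x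
    negate-difference = solve-∀

  mod-trans : ∀ {x y z} → x ≡ y mod m → y ≡ z mod m → x ≡ z mod m
  mod-trans {x} {y} {z} x≡y y≡z =
    congruent $ subst (+ m Signed.∣_) (telescope x y z)
      (∣m∣n⇒∣m+n (divides-difference x≡y) (divides-difference y≡z))
    where
    telescope : ∀ x y z → (x - y) + (y - z) ≡ x - z
    telescope = solve-∀

  mod-isEquivalence : IsEquivalence (λ x y → x ≡ y mod m)
  mod-isEquivalence = record { refl = mod-refl ; sym = mod-sym ; trans = mod-trans }

  +-cong-mod : ∀ {x y u v} → x ≡ y mod m → u ≡ v mod m → x + u ≡ y + v mod m
  +-cong-mod {x} {y} {u} {v} x≡y u≡v =
    congruent $ subst (+ m Signed.∣_) (difference-of-sums x y u v)
      (∣m∣n⇒∣m+n (divides-difference x≡y) (divides-difference u≡v))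
    where
    difference-of-sums : ∀ x y u v → (x - y) + (u - v) ≡ (x + u) - (y + v)
    difference-of-sums = solve-∀

  *-cong-mod : ∀ {x y u v} → x ≡ y mod m → u ≡ v mod m → x * u ≡ y * v mod m
  *-cong-mod {x} {y} {u} {v} x≡y u≡v =
    congruent $ subst (+ m Signed.∣_) (difference-of-products x y u v)
      (∣m∣n⇒∣m+n (∣m⇒∣m*n u (divides-difference x≡y)) (∣n⇒∣m*n y (divides-difference u≡v)))
    where
    difference-of-products : ∀ x y u v → (x - y) * u + y * (u - v) ≡ x * u - y * v
    difference-of-products = solve-∀

  ^-cong-mod : ∀ {x y} n → x ≡ y mod m → x ^ n ≡ y ^ n mod m
  ^-cong-mod zero    x≡y = mod-refl
  ^-cong-mod (suc n) x≡y = *-cong-mod x≡y (^-cong-mod n x≡y)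

modSetoid : ℕ → Setoid 0ℓ 0ℓ
modSetoid m = record { isEquivalence = mod-isEquivalence {m} }

module mod-Reasoning (m : ℕ) = Relation.Binary.Reasoning.Setoid (modSetoid m)

∣⇒≡0-mod : ∀ {m x} → + m Signed.∣ x → x ≡ 0ℤ mod m
∣⇒≡0-mod {m} {x} m∣x = congruent (subst (+ m Signed.∣_) (sym (ℤ.+-identityʳ x)) m∣x)

∣-resp-≡mod : ∀ {m x y} → x ≡ y mod m → + m ∣ x → + m ∣ y
∣-resp-≡mod {m} {x} {y} x≡y m∣x = ∣⇒∣ᵤ $ subst (+ m Signed.∣_) (ℤ.+-identityʳ y) $
  divides-difference (mod-trans (mod-sym x≡y) (∣⇒≡0-mod (∣ᵤ⇒∣ m∣x)))

∣-difference⇒≡-mod : ∀ {m x y} → + m ∣ x - y → x ≡ y mod m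
∣-difference⇒≡-mod m∣x-y = congruent (∣ᵤ⇒∣ m∣x-y)

[k+1]*[n+1]C[k+1]≡[n+1]*nCk : ∀ n k → suc k ℕ.* (suc n C suc k) ≡ suc n ℕ.* (n C k)
[k+1]*[n+1]C[k+1]≡[n+1]*nCk zero    zero    = refl
[k+1]*[n+1]C[k+1]≡[n+1]*nCk zero    (suc k) = ℕ.*-zeroʳ (suc (suc k))
[k+1]*[n+1]C[k+1]≡[n+1]*nCk (suc n) zero    =
  trans (ℕ.+-identityʳ _) (trans (nC1≡n (suc (suc n))) (sym (ℕ.*-identityʳ _)))
[k+1]*[n+1]C[k+1]≡[n+1]*nCk (suc n) (suc k) = begin
  suc (suc k) ℕ.* (suc (suc n) C suc (suc k))          ≡⟨ cong (suc (suc k) ℕ.*_) (pascal (suc n) (suc k)) ⟨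
  suc (suc k) ℕ.* (a ℕ.+ b)                             ≡⟨ ℕ.*-distribˡ-+ (suc (suc k)) a b ⟩
  a ℕ.+ suc k ℕ.* a ℕ.+ suc (suc k) ℕ.* b               ≡⟨ cong₂ (λ u v → a ℕ.+ u ℕ.+ v) (absorb n k) (absorb n (suc k)) ⟩
  a ℕ.+ suc n ℕ.* (n C k) ℕ.+ suc n ℕ.* (n C suc k)     ≡⟨ ℕ.+-assoc a (suc n ℕ.* (n C k)) _ ⟩
  a ℕ.+ (suc n ℕ.* (n C k) ℕ.+ suc n ℕ.* (n C suc k))   ≡⟨ cong (a ℕ.+_) (ℕ.*-distribˡ-+ (suc n) (n C k) (n C suc k)) ⟨
  a ℕ.+ suc n ℕ.* (n C k ℕ.+ n C suc k)                 ≡⟨ cong (λ c → a ℕ.+ suc n ℕ.* c) (pascal n k) ⟩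
  a ℕ.+ suc n ℕ.* a                                     ∎
  where
  open ≡-Reasoning
  pascal : ∀ n k → n C k ℕ.+ n C suc k ≡ suc n C suc k
  pascal = nCk+nC[k+1]≡[n+1]C[k+1]
  absorb : ∀ n k → suc k ℕ.* (suc n C suc k) ≡ suc n ℕ.* (n C k)
  absorb = [k+1]*[n+1]C[k+1]≡[n+1]*nCk
  a b : ℕ
  a = suc n C suc k
  b = suc n C suc (suc k)

prime∣pCk : ∀ {p k} → Prime p → 0 < k → k < p → p ℕ.∣ p C k
prime∣pCk {suc n} {suc k} p-prime _ k<p
  with euclidsLemma (suc k) (suc n C suc k) p-prime
         (divides (n C k) (trans ([k+1]*[n+1]C[k+1]≡[n+1]*nCk n k) (ℕ.*-comm (suc n) (n C k))))
... | inj₁ p∣k+1 = ⊥-elim (ℕ.<⇒≱ k<p (ℕ.∣⇒≤ p∣k+1))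
... | inj₂ p∣pCk = p∣pCk

·≡* : ∀ n x → n · x ≡ + n * x
·≡* zero    x = sym (ℤ.*-zeroˡ x)
·≡* (suc n) x = begin
  x + n · x          ≡⟨ cong (_+_ x) (·≡* n x) ⟩
  x + + n * x        ≡⟨ cong (_+ + n * x) (ℤ.*-identityˡ x) ⟨
  1ℤ * x + + n * x   ≡⟨ ℤ.*-distribʳ-+ x 1ℤ (+ n) ⟨
  + suc n * x        ∎
  where open ≡-Reasoning

^′≡^ : ∀ x n → x ^′ n ≡ x ^ n
^′≡^ x zero    = refl
^′≡^ x (suc n) = cong (x *_) (^′≡^ x n)

binomialTerm≡ : ∀ x y n (k : Fin (suc n)) →
  binomialTerm x y n k ≡ + (n C toℕ k) * (x ^ toℕ k * y ^ (n ℕ.∸ toℕ k))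
binomialTerm≡ x y n k = trans (·≡* (n C toℕ k) _)
  (cong (+ (n C toℕ k) *_) (cong₂ _*_ (^′≡^ x (toℕ k)) (^′≡^ y (n ℕ.∸ toℕ k))))

binomialTerm-first : ∀ x y n → binomialTerm x y n zero ≡ y ^ n
binomialTerm-first x y n = begin
  binomialTerm x y n zero  ≡⟨ binomialTerm≡ x y n zero ⟩
  1ℤ * (1ℤ * y ^ n)        ≡⟨ ℤ.*-identityˡ _ ⟩
  1ℤ * y ^ n               ≡⟨ ℤ.*-identityˡ _ ⟩
  y ^ n                    ∎
  where open ≡-Reasoning

binomialTerm-last : ∀ x y n → binomialTerm x y n (fromℕ n) ≡ x ^ n
binomialTerm-last x y n = begin
  binomialTerm x y n (fromℕ n)                   ≡⟨ binomialTerm≡ x y n (fromℕ n) ⟩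
  + (n C k) * (x ^ k * y ^ (n ℕ.∸ k))           ≡⟨ cong (λ k → + (n C k) * (x ^ k * y ^ (n ℕ.∸ k))) (toℕ-fromℕ n) ⟩
  + (n C n) * (x ^ n * y ^ (n ℕ.∸ n))           ≡⟨ cong₂ (λ c e → + c * (x ^ n * y ^ e)) (nCn≡1 n) (ℕ.n∸n≡0 n) ⟩
  1ℤ * (x ^ n * 1ℤ)                              ≡⟨ ℤ.*-identityˡ _ ⟩
  x ^ n * 1ℤ                                     ≡⟨ ℤ.*-identityʳ _ ⟩
  x ^ n                                          ∎
  where
  open ≡-Reasoning
  k : ℕ
  k = toℕ (fromℕ n)

sum≡last-mod : ∀ {m n} (t : Vector ℤ (suc n)) → (∀ i → t (inject₁ i) ≡ 0ℤ mod m) →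
               sum t ≡ t (fromℕ n) mod m
sum≡last-mod {m} {zero}  t _      = mod-reflexive (ℤ.+-identityʳ (t zero))
sum≡last-mod {m} {suc n} t init≡0 = begin
  t zero + sum (t ∘ suc)  ≈⟨ +-cong-mod (init≡0 zero) (sum≡last-mod (t ∘ suc) (init≡0 ∘ suc)) ⟩
  0ℤ + t (fromℕ (suc n))  ≡⟨ ℤ.+-identityˡ _ ⟩
  t (fromℕ (suc n))       ∎
  where open mod-Reasoning m

sum≡first+last-mod : ∀ {m n} (t : Vector ℤ (suc (suc n))) → (∀ i → t (suc (inject₁ i)) ≡ 0ℤ mod m) →
                     sum t ≡ t zero + t (fromℕ (suc n)) mod m
sum≡first+last-mod t middle≡0 = +-cong-mod (mod-refl {x = t zero}) (sum≡last-mod (t ∘ suc) middle≡0)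

freshman's-dream : ∀ {p} → Prime p → ∀ x → (x + 1ℤ) ^ p ≡ x ^ p + 1ℤ mod p
freshman's-dream {zero}  p-prime = ⊥-elim (¬prime[0] p-prime)
freshman's-dream {p@(suc n)} p-prime x = begin
  (x + 1ℤ) ^ p                    ≡⟨ ^′≡^ (x + 1ℤ) p ⟨
  (x + 1ℤ) ^′ p                   ≡⟨ binomial-theorem p x 1ℤ ⟩
  sum t                           ≈⟨ sum≡first+last-mod t middle≡0 ⟩
  t zero + t (fromℕ p)            ≡⟨ cong₂ _+_ (binomialTerm-first x 1ℤ p) (binomialTerm-last x 1ℤ p) ⟩
  1ℤ ^ p + x ^ p                  ≡⟨ cong (_+ x ^ p) (ℤ.^-zeroˡ p) ⟩
  1ℤ + x ^ p                      ≡⟨ ℤ.+-comm 1ℤ (x ^ p) ⟩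
  x ^ p + 1ℤ                      ∎
  where
  open mod-Reasoning p
  t : Vector ℤ (suc p)
  t = binomialTerm x 1ℤ p
  middle≡0 : ∀ i → t (suc (inject₁ i)) ≡ 0ℤ mod p
  middle≡0 i = ∣⇒≡0-mod $ subst (+ p Signed.∣_) (sym (binomialTerm≡ x 1ℤ p k))
    (∣m⇒∣m*n {m = + (p C toℕ k)} _ (∣ᵤ⇒∣ (prime∣pCk p-prime (s≤s z≤n) (s≤s k-1<n))))
    where
    k : Fin (suc p)
    k = suc (inject₁ i)
    k-1<n : toℕ (inject₁ i) < n
    k-1<n = subst (_< n) (sym (toℕ-inject₁ i)) (toℕ<n i)

*-cancelˡ-mod : ∀ {p x y} z → Prime p → ¬ p ℕ.∣ ∣ z ∣ → z * x ≡ z * y mod p → x ≡ y mod p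
*-cancelˡ-mod {p} {x} {y} z p-prime p∤z (congruent p∣zx-zy)
  with euclidsLemma ∣ z ∣ ∣ x - y ∣ p-prime p∣∣z∣∣x-y∣
  where
  factor : ∀ z x y → z * x - z * y ≡ z * (x - y)
  factor = solve-∀
  p∣∣z∣∣x-y∣ : p ℕ.∣ ∣ z ∣ ℕ.* ∣ x - y ∣
  p∣∣z∣∣x-y∣ =
    subst (p ℕ.∣_) (ℤ.abs-* z (x - y)) (∣⇒∣ᵤ (subst (+ p Signed.∣_) (factor z x y) p∣zx-zy))
... | inj₁ p∣z     = ⊥-elim (p∤z p∣z)
... | inj₂ p∣∣x-y∣ = congruent (∣ᵤ⇒∣ p∣∣x-y∣)

0ℤ^n≡0 : ∀ n .{{_ : ℕ.NonZero n}} → 0ℤ ^ n ≡ 0ℤ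
0ℤ^n≡0 (suc n) = ℤ.*-zeroˡ (0ℤ ^ n)

fermat : ∀ {p} → Prime p → ∀ a → (+ a) ^ p ≡ + a mod p
fermat {p} p-prime zero    = mod-reflexive (0ℤ^n≡0 p {{prime⇒nonZero p-prime}})
fermat {p} p-prime (suc a) = begin
  (+ suc a) ^ p          ≡⟨ cong (_^ p) +[1+a]≡+a+1 ⟩
  (+ a + 1ℤ) ^ p         ≈⟨ freshman's-dream p-prime (+ a) ⟩
  (+ a) ^ p + 1ℤ         ≈⟨ +-cong-mod (fermat p-prime a) mod-refl ⟩
  + a + 1ℤ               ≡⟨ +[1+a]≡+a+1 ⟨
  + suc a                ∎
  where
  open mod-Reasoning p
  +[1+a]≡+a+1 : + suc a ≡ + a + 1ℤ
  +[1+a]≡+a+1 = trans (cong +_ (ℕ.+-comm 1 a)) (ℤ.pos-+ a 1)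

fermat-unit : ∀ {p a} → Prime p → ¬ p ℕ.∣ a → (+ a) ^ (p ℕ.∸ 1) ≡ 1ℤ mod p
fermat-unit {zero}      p-prime = ⊥-elim (¬prime[0] p-prime)
fermat-unit {p@(suc n)} {a} p-prime p∤a = *-cancelˡ-mod (+ a) p-prime p∤a $ begin
  + a * (+ a) ^ n   ≈⟨ fermat p-prime a ⟩
  + a               ≡⟨ ℤ.*-identityʳ (+ a) ⟨
  + a * 1ℤ          ∎
  where open mod-Reasoning p

nonZeroIndicator : ℕ → ℤ
nonZeroIndicator zero    = 0ℤ
nonZeroIndicator (suc _) = 1ℤ

fermat-power : ∀ {p ℓ a} → Prime p → 1 ≤ ℓ → a < p →
               (+ a) ^ ((p ℕ.∸ 1) ℕ.^ ℓ) ≡ nonZeroIndicator a mod p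
fermat-power {zero}          p-prime = ⊥-elim (¬prime[0] p-prime)
fermat-power {suc zero}      p-prime = ⊥-elim (¬prime[1] p-prime)
fermat-power {p@(suc (suc n))} {ℓ} {zero} p-prime _ _ =
  mod-reflexive (0ℤ^n≡0 (suc n ℕ.^ ℓ) {{ℕ.m^n≢0 (suc n) ℓ}})
fermat-power {p@(suc (suc n))} {suc ℓ} {a@(suc _)} p-prime _ a<p = begin
  (+ a) ^ (suc n ℕ.* suc n ℕ.^ ℓ)   ≡⟨ ℤ.^-*-assoc (+ a) (suc n) (suc n ℕ.^ ℓ) ⟨
  ((+ a) ^ suc n) ^ (suc n ℕ.^ ℓ)   ≈⟨ ^-cong-mod (suc n ℕ.^ ℓ) (fermat-unit p-prime (ℕ.>⇒∤ a<p)) ⟩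
  1ℤ ^ (suc n ℕ.^ ℓ)                ≡⟨ ℤ.^-zeroˡ (suc n ℕ.^ ℓ) ⟩
  1ℤ                                ∎
  where open mod-Reasoning p

reducedDisplacement : ℤ → ℕ → ℤ
reducedDisplacement c₀ z = nonZeroIndicator z + c₀ - + z

^ℤ≡^ : ∀ x n → x ^ℤ n ≡ x ^ n
^ℤ≡^ x zero    = refl
^ℤ≡^ x (suc n) = cong (x *_) (^ℤ≡^ x n)

displacement≡reduced : ∀ {p ℓ c c₀ z} → Prime p → 1 ≤ ℓ → z < p → c ≡ c₀ mod p →
  φ ((p ℕ.∸ 1) ℕ.^ ℓ) c (+ z) - + z ≡ reducedDisplacement c₀ z mod p
displacement≡reduced {p} {ℓ} {z = z} p-prime 1≤ℓ z<p c≡c₀ =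
  +-cong-mod (+-cong-mod power≡indicator c≡c₀) mod-refl
  where
  power≡indicator : (+ z) ^ℤ ((p ℕ.∸ 1) ℕ.^ ℓ) ≡ nonZeroIndicator z mod p
  power≡indicator =
    mod-trans (mod-reflexive (^ℤ≡^ (+ z) ((p ℕ.∸ 1) ℕ.^ ℓ))) (fermat-power p-prime 1≤ℓ z<p)

∣reducedDisplacement∣<p : ∀ {p c₀ z} → ∣ c₀ ∣ ≤ 1 → 1 < p → z < p →
                          ∣ reducedDisplacement c₀ z ∣ < p
∣reducedDisplacement∣<p {p} {c₀} {zero}  ∣c₀∣≤1 1<p _ = begin-strict
  ∣ 0ℤ + c₀ - 0ℤ ∣  ≡⟨ cong ∣_∣ (drop-zeros c₀) ⟩
  ∣ c₀ ∣            ≤⟨ ∣c₀∣≤1 ⟩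
  1                 <⟨ 1<p ⟩
  p                 ∎
  where
  open ℕ.≤-Reasoning
  drop-zeros : ∀ c → 0ℤ + c - 0ℤ ≡ c
  drop-zeros = solve-∀
∣reducedDisplacement∣<p {p} {c₀} {suc w} ∣c₀∣≤1 _ z<p = begin-strict
  ∣ 1ℤ + c₀ - (1ℤ + + w) ∣  ≡⟨ cong ∣_∣ (cancel-ones c₀ (+ w)) ⟩
  ∣ c₀ - + w ∣              ≤⟨ ℤ.∣i-j∣≤∣i∣+∣j∣ c₀ (+ w) ⟩
  ∣ c₀ ∣ ℕ.+ w              ≤⟨ ℕ.+-monoˡ-≤ w ∣c₀∣≤1 ⟩
  suc w                     <⟨ z<p ⟩
  p                         ∎
  where
  open ℕ.≤-Reasoning
  cancel-ones : ∀ c w → 1ℤ + c - (1ℤ + w) ≡ c - w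
  cancel-ones = solve-∀

bounded-multiple≡0 : ∀ {m x} → ∣ x ∣ < m → + m ∣ x → x ≡ 0ℤ
bounded-multiple≡0 {m} {x} ∣x∣<m m∣x with ∣ x ∣ in ∣x∣≡
... | zero  = ℤ.∣i∣≡0⇒i≡0 ∣x∣≡
... | suc _ = ⊥-elim (ℕ.>⇒∤ ∣x∣<m m∣x)

root? : ∀ c₀ {n} (z : Fin n) → Dec (reducedDisplacement c₀ (toℕ z) ≡ 0ℤ)
root? c₀ z = reducedDisplacement c₀ (toℕ z) ℤ.≟ 0ℤ

zeroCount : ℤ → ℕ → ℕ
zeroCount c₀ n = length (filter (root? c₀) (allFin n))

M≡zeroCount : ∀ {p ℓ c c₀} → Prime p → 1 ≤ ℓ → ∣ c₀ ∣ ≤ 1 → c ≡ c₀ mod p →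
              M p ℓ c ≡ zeroCount c₀ p
M≡zeroCount {p} {ℓ} {c} {c₀} p-prime 1≤ℓ ∣c₀∣≤1 c≡c₀ =
  cong length (filter-≐ _ _ (fixed⇒root , root⇒fixed) (allFin p))
  where
  displacement : Fin p → ℤ
  displacement z = φ ((p ℕ.∸ 1) ℕ.^ ℓ) c (+ toℕ z) - + toℕ z
  displacement≡ : ∀ z → displacement z ≡ reducedDisplacement c₀ (toℕ z) mod p
  displacement≡ z = displacement≡reduced p-prime 1≤ℓ (toℕ<n z) c≡c₀
  fixed⇒root : ∀ {z} → + p ∣ displacement z → reducedDisplacement c₀ (toℕ z) ≡ 0ℤ
  fixed⇒root {z} p∣displacement = bounded-multiple≡0
    (∣reducedDisplacement∣<p ∣c₀∣≤1 (ℕ.nonTrivial⇒n>1 p {{prime⇒nonTrivial p-prime}}) (toℕ<n z))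
    (∣-resp-≡mod (displacement≡ z) p∣displacement)
  root⇒fixed : ∀ {z} → reducedDisplacement c₀ (toℕ z) ≡ 0ℤ → + p ∣ displacement z
  root⇒fixed {z} root = ∣-resp-≡mod (mod-sym (displacement≡ z)) (subst (+ p ∣_) (sym root) (p ℕ.∣0))

-- Past the residues 0, 1, 2 (decided by evaluation in the lemmas below), reducedDisplacement c₀ z
-- normalises to a negative literal -[1+ _ ] for c₀ ∈ {1, 0, -1}, so the hypothesis is λ _ ().
no-roots-beyond-2 : ∀ {c₀ k} → (∀ (i : Fin k) → reducedDisplacement c₀ (3 ℕ.+ toℕ i) ≢ 0ℤ) →
  length (filter (root? c₀ {3 ℕ.+ k}) (tabulate (λ i → suc (suc (suc i))))) ≡ 0
no-roots-beyond-2 {c₀} {k} ≢0 =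
  cong length (filter-none (root? c₀ {3 ℕ.+ k}) (tabulate⁺ {f = λ i → suc (suc (suc i))} ≢0))

zeroCount[1]≡1 : ∀ {n} → 3 ≤ n → zeroCount 1ℤ n ≡ 1
zeroCount[1]≡1 {suc (suc (suc k))} (s≤s (s≤s (s≤s _))) = cong suc (no-roots-beyond-2 {1ℤ} {k} λ _ ())

zeroCount[0]≡2 : ∀ {n} → 3 ≤ n → zeroCount 0ℤ n ≡ 2
zeroCount[0]≡2 {suc (suc (suc k))} (s≤s (s≤s (s≤s _))) = cong (2 ℕ.+_) (no-roots-beyond-2 {0ℤ} {k} λ _ ())

zeroCount[-1]≡0 : ∀ {n} → 3 ≤ n → zeroCount ℤ.-1ℤ n ≡ 0
zeroCount[-1]≡0 {suc (suc (suc k))} (s≤s (s≤s (s≤s _))) = no-roots-beyond-2 {ℤ.-1ℤ} {k} λ _ ()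

corollary3p4 : (p ℓ : ℕ) → Prime p → 5 ≤ p → 1 ≤ ℓ →
    ((c : ℤ) → (+ p) ∣ (c - + 1) → M p ℓ c ≡ 1) ×
    ((t : ℤ) → M p ℓ (+ p * t) ≡ 2) ×
    ((c : ℤ) → (+ p) ∣ (c + + 1) → M p ℓ c ≡ 0)
corollary3p4 p ℓ p-prime 5≤p 1≤ℓ =
    (λ c p∣c-1 → trans (M≡zeroCount p-prime 1≤ℓ ℕ.≤-refl (∣-difference⇒≡-mod p∣c-1)) (zeroCount[1]≡1 3≤p))
  , (λ t → trans (M≡zeroCount p-prime 1≤ℓ z≤n (∣⇒≡0-mod (∣m⇒∣m*n t Signed.∣-refl))) (zeroCount[0]≡2 3≤p))
  , (λ c p∣c+1 → trans (M≡zeroCount p-prime 1≤ℓ ℕ.≤-refl (∣-difference⇒≡-mod p∣c+1)) (zeroCount[-1]≡0 3≤p))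
  where
  3≤p : 3 ≤ p
  3≤p = ℕ.≤-trans (ℕ.m≤m+n 3 2) 5≤p
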